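{- In the setting below, for every $x\in\Sigma^*$ and every $u\in\overline\Sigma^+$: $x^\bullet\preceq u^\bullet$ in $\mathcal K$ if and only if $x\leqslant_L u$.
   Context: Let $\mathcal K=(K;\preceq,\cdot,\backslash,/,\wedge,\vee,\top,\bot,\mathbf 1)$ be an algebra where $(K;\preceq,\wedge,\vee,\top,\bot)$ is a bounded lattice, $(K;\cdot,\mathbf 1)$ a monoid, $b\preceq a\backslash c\iff a\cdot b\preceq c\iff a\preceq c/b$, with moreover $a^+=\sup\{a^n\mid n\ge1\}$ existing for all $a$ (an infinitary action lattice). Let $\overline\Sigma=\{\overline a\mid a\in K\}$, $\underline\Sigma=\{\underline b\mid b\in K\}$ be disjoint copies of $K$, $\Sigma=\overline\Sigma\cup\underline\Sigma$. For $x\in\Sigma^*$, write $x=w_0\underline{d_1}w_1\cdots\underline{d_n}w_n$ with $w_i\in\overline\Sigma^*$ and set $x^\bullet=a_1\cdot\ldots\cdot a_k$ where $\overline{a_1}\cdots\overline{a_k}=w_0w_1\cdots w_n$ (letters from $\underline\Sigma$ are ignored; the empty product is $\mathbf 1$). Let $L=\{x\underline b\mid x\in\Sigma^*,b\in K,x^\bullet\preceq b\}\cup\{z\in\Sigma^*\mid z^\bullet=\bot\}$. For $x,y\in\Sigma^*$, $x\leqslant_L y$ means: for all $s,t\in\Sigma^*$, $syt\in L$ implies $sxt\in L$. -}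

module Defs where

open import Level using (Level; suc; _⊔_)
open import Data.Nat using (ℕ; zero) renaming (suc to sucℕ)
open import Data.Product using (Σ; _×_; ∃; ∃-syntax; _,_)
open import Data.Sum using (_⊎_; inj₁; inj₂)
open import Data.List using (List; []; _∷_; _++_; [_])
open import Data.List.NonEmpty using (List⁺; toList)
import Data.List as L
open import Relation.Binary.PropositionalEquality using (_≡_)
open import Function.Bundles using (_⇔_)

powr : ∀ {c} {K : Set c} → (K → K → K) → K → K → ℕ → K
powr _·_ e a zero = e
powr _·_ e a (sucℕ n) = a · powr _·_ e a n

record InfActionLattice (c ℓ : Level) : Set (suc (c ⊔ ℓ)) where
  infixl 7 _·_
  infix  4 _≼_
  field
    K     : Set c
    _≼_   : K → K → Set ℓ
    ≼-refl  : ∀ {a} → a ≼ a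
    ≼-trans : ∀ {a b c} → a ≼ b → b ≼ c → a ≼ c
    ≼-antisym : ∀ {a b} → a ≼ b → b ≼ a → a ≡ b
    _∧_ : K → K → K
    _∨_ : K → K → K
    ∧-lb₁ : ∀ a b → (a ∧ b) ≼ a
    ∧-lb₂ : ∀ a b → (a ∧ b) ≼ b
    ∧-glb : ∀ {a b c} → c ≼ a → c ≼ b → c ≼ (a ∧ b)
    ∨-ub₁ : ∀ a b → a ≼ (a ∨ b)
    ∨-ub₂ : ∀ a b → b ≼ (a ∨ b)
    ∨-lub : ∀ {a b c} → a ≼ c → b ≼ c → (a ∨ b) ≼ c
    ⊤ₖ : K
    ⊥ₖ : K
    ⊤-max : ∀ a → a ≼ ⊤ₖ
    ⊥-min : ∀ a → ⊥ₖ ≼ a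
    _·_ : K → K → K
    𝟏   : K
    ·-assoc : ∀ a b c → (a · b) · c ≡ a · (b · c)
    ·-idˡ : ∀ a → 𝟏 · a ≡ a
    ·-idʳ : ∀ a → a · 𝟏 ≡ a
    _＼_ : K → K → K
    _／_ : K → K → K
    res-＼ : ∀ a b c → (b ≼ a ＼ c) ⇔ (a · b ≼ c)
    res-／ : ∀ a b c → (a · b ≼ c) ⇔ (a ≼ c ／ b)
    _⁺ : K → K

    ⁺-ub  : ∀ a n → powr _·_ 𝟏 a (sucℕ n) ≼ a ⁺
    ⁺-lub : ∀ a c → (∀ n → powr _·_ 𝟏 a (sucℕ n) ≼ c) → a ⁺ ≼ c

module Language {c ℓ : Level} (𝒦 : InfActionLattice c ℓ) where
  open InfActionLattice 𝒦

  -- Σ = overline-Σ ∪ underline-Σ : inj₁ a = over a, inj₂ b = under b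
  Letter : Set c
  Letter = K ⊎ K

  over : K → Letter
  over = inj₁

  under : K → Letter
  under = inj₂

  prod : List K → K
  prod [] = 𝟏
  prod (a ∷ as) = a · prod as

  bullet : List Letter → K
  bullet [] = 𝟏
  bullet (inj₁ a ∷ x) = a · bullet x
  bullet (inj₂ b ∷ x) = bullet x

  InL : List Letter → Set (c ⊔ ℓ)
  InL z = (∃[ x ] ∃[ b ] (z ≡ x ++ [ under b ] × bullet x ≼ b)) ⊎ (bullet z ≡ ⊥ₖ)

  _⩽L_ : List Letter → List Letter → Set (c ⊔ ℓ)
  x ⩽L y = ∀ (s t : List Letter) → InL (s ++ y ++ t) → InL (s ++ x ++ t)

  overWord : List⁺ K → List Letter
  overWord u = L.map over (toList u)

  Lemma9Statement : Set (c ⊔ ℓ)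
  Lemma9Statement = ∀ (x : List Letter) (u : List⁺ K) →
      (bullet x ≼ bullet (overWord u)) ⇔ (x ⩽L overWord u)

{-# OPTIONS --safe #-}
module Submission where

open import Defs
open import Level using (Level)
open import Data.Product using (∃₂; _,_)
open import Data.Sum using (inj₁; inj₂)
open import Data.List using (List; []; _∷_; _++_; [_]; _∷ʳ_; map; InitLast; initLast; _∷ʳ′_)
open import Data.List.NonEmpty using (_∷_)
open import Data.List.Properties using (∷ʳ-injective; ++-assoc; ++-identityʳ)
open import Relation.Binary.PropositionalEquality using (_≡_; refl; sym; trans; cong; subst; subst₂)
open import Relation.Nullary using (¬_)
open import Data.Empty using (⊥-elim)
open import Function.Bundles using (_⇔_; mk⇔; Equivalence)

-- Residuation makes multiplication monotone, so x• ≼ u• gives (s x t)• ≼ (s u t)•, and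
-- both clauses of L are downward closed in the bullet value. The clause "ends in an
-- underlined b" moves from s u t to s x t because u ends in an overlined letter, so
-- the final underlined letter lies in t. Conversely, x ⩽L u tested in the context
-- (ε, under u•) gives x• ≼ u•.

++-++-∷ʳ : ∀ {a} {A : Set a} (s y t : List A) l → s ++ y ++ (t ∷ʳ l) ≡ (s ++ y ++ t) ∷ʳ l
++-++-∷ʳ s y t l = sym (trans (++-assoc s (y ++ t) [ l ]) (cong (s ++_) (++-assoc y t [ l ])))

module _ {c ℓ : Level} (𝒦 : InfActionLattice c ℓ) where
  open InfActionLattice 𝒦
  open Language 𝒦
  open Equivalence

  ·-monoʳ-≼ : ∀ a {b b′} → b ≼ b′ → a · b ≼ a · b′
  ·-monoʳ-≼ a {b} {b′} b≼b′ =
    to (res-＼ a b (a · b′)) (≼-trans b≼b′ (from (res-＼ a b′ (a · b′)) ≼-refl))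

  ·-monoˡ-≼ : ∀ b {a a′} → a ≼ a′ → a · b ≼ a′ · b
  ·-monoˡ-≼ b {a} {a′} a≼a′ =
    from (res-／ a b (a′ · b)) (≼-trans a≼a′ (to (res-／ a′ b (a′ · b)) ≼-refl))

  ≼⊥⇒≡⊥ : ∀ {a} → a ≼ ⊥ₖ → a ≡ ⊥ₖ
  ≼⊥⇒≡⊥ a≼⊥ = ≼-antisym a≼⊥ (⊥-min _)

  bullet-++ : ∀ x y → bullet (x ++ y) ≡ bullet x · bullet y
  bullet-++ []           y = sym (·-idˡ _)
  bullet-++ (inj₁ a ∷ x) y = trans (cong (a ·_) (bullet-++ x y)) (sym (·-assoc _ _ _))
  bullet-++ (inj₂ b ∷ x) y = bullet-++ x y

  bullet-∷ʳ-under : ∀ x b → bullet (x ∷ʳ under b) ≡ bullet x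
  bullet-∷ʳ-under x b = trans (bullet-++ x [ under b ]) (·-idʳ _)

  bullet-mono-infix : ∀ {x y} → bullet x ≼ bullet y →
                      ∀ s t → bullet (s ++ x ++ t) ≼ bullet (s ++ y ++ t)
  bullet-mono-infix {x} {y} x≼y s t =
    subst₂ _≼_ (sym (bullet-infix x)) (sym (bullet-infix y))
      (·-monoʳ-≼ (bullet s) (·-monoˡ-≼ (bullet t) x≼y))
    where
    bullet-infix : ∀ w → bullet (s ++ w ++ t) ≡ bullet s · (bullet w · bullet t)
    bullet-infix w = trans (bullet-++ s (w ++ t)) (cong (bullet s ·_) (bullet-++ w t))

  InL-∷ʳ-under : ∀ x b → InL (x ∷ʳ under b) ⇔ (bullet x ≼ b)
  InL-∷ʳ-under x b = mk⇔ sound (λ x≼b → inj₁ (x , b , refl , x≼b))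
    where
    sound : InL (x ∷ʳ under b) → bullet x ≼ b
    sound (inj₁ (z , b′ , eq , z≼b′)) with ∷ʳ-injective x z eq
    ... | refl , refl = z≼b′
    sound (inj₂ ≡⊥) = subst (_≼ b) (sym (trans (sym (bullet-∷ʳ-under x b)) ≡⊥)) (⊥-min b)

  ∷ʳ-over≢∷ʳ-under : ∀ w z {a b} → ¬ (w ∷ʳ over a ≡ z ∷ʳ under b)
  ∷ʳ-over≢∷ʳ-under w z eq with ∷ʳ-injective w z eq
  ... | _ , ()

  EndsOverlined : List Letter → Set c
  EndsOverlined y = ∃₂ λ w a → y ≡ w ∷ʳ over a

  overWord-endsOverlined : ∀ u → EndsOverlined (overWord u)
  overWord-endsOverlined (a ∷ as) = over-∷-map-over a as
    where
    over-∷-map-over : ∀ a as → EndsOverlined (over a ∷ map over as)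
    over-∷-map-over a []       = [] , a , refl
    over-∷-map-over a (b ∷ bs) with over-∷-map-over b bs
    ... | w , a′ , eq = over a ∷ w , a′ , cong (over a ∷_) eq

  ≼⇒⩽L : ∀ {x y} → EndsOverlined y → bullet x ≼ bullet y → x ⩽L y
  ≼⇒⩽L {x} {y} _ x≼y s t (inj₂ ≡⊥) =
    inj₂ (≼⊥⇒≡⊥ (subst (bullet (s ++ x ++ t) ≼_) ≡⊥ (bullet-mono-infix {x} {y} x≼y s t)))
  ≼⇒⩽L {x} (w , a , refl) x≼y s t (inj₁ (z , b , eq , z≼b)) = by-initLast (initLast t) eq
    where
    y = w ∷ʳ over a

    by-initLast : ∀ {t} → InitLast t → s ++ y ++ t ≡ z ∷ʳ under b → InL (s ++ x ++ t)
    by-initLast [] eq′ = ⊥-elim (∷ʳ-over≢∷ʳ-under (s ++ w) z (trans s++y++[]≡ eq′))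
      where
      s++y++[]≡ : (s ++ w) ∷ʳ over a ≡ s ++ y ++ []
      s++y++[]≡ = trans (++-assoc s w [ over a ]) (cong (s ++_) (sym (++-identityʳ y)))
    by-initLast (t′ ∷ʳ′ l) eq′ with ∷ʳ-injective (s ++ y ++ t′) z (trans (sym (++-++-∷ʳ s y t′ l)) eq′)
    ... | refl , refl =
      subst InL (sym (++-++-∷ʳ s x t′ (under b)))
        (from (InL-∷ʳ-under _ b) (≼-trans (bullet-mono-infix x≼y s t′) z≼b))

  ⩽L⇒≼ : ∀ {x y} → x ⩽L y → bullet x ≼ bullet y
  ⩽L⇒≼ {x} {y} x⩽y = to (InL-∷ʳ-under x (bullet y))
    (x⩽y [] [ under (bullet y) ] (from (InL-∷ʳ-under y (bullet y)) ≼-refl))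

lemma9 : ∀ {c ℓ : Level} (𝒦 : InfActionLattice c ℓ) → Language.Lemma9Statement 𝒦
lemma9 𝒦 x u = mk⇔ (≼⇒⩽L 𝒦 (overWord-endsOverlined 𝒦 u)) (⩽L⇒≼ 𝒦)
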